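{- Let $M$ be a partial multiplication matrix whose row-column graph has at least one cycle, and let $\pi^\natural$ be a gridded $M$-coil defined on a cycle of $G_M$ of length $\ell$, with underlying permutation $\pi$. Let $\pi^\#$ be any other $M$-gridding of $\pi$, and let $c_1,\dots,c_r$ be the non-empty cells of $\pi^\#$ that lie in some single row, or in some single column, of the gridding. If cell $c_i$ contains $k_i$ points for $1\le i\le r$, and $S_i=\sum_{j\ne i}k_j$, then $k_i\le 2\ell(S_i+1)$ for each $i$.
   Context: A gridding matrix is a matrix with entries in $\{0,1,-1\}$ ($m$ columns, $n$ rows; $M_{ij}$ in column $i$ from the left, row $j$ from the bottom). An $M$-gridding of a permutation is a division of its plot by $m-1$ vertical and $n-1$ horizontal lines into cells, each point interior to a cell, with cell $ij$ empty if $M_{ij}=0$, increasing if $M_{ij}=1$, decreasing if $M_{ij}=-1$; an $M$-gridded permutation is a permutation with a fixed $M$-gridding. The row-column graph $G_M$ is the bipartite graph on columns $1,\dots,m$ and rows $1',\dots,n'$ with edge $ij'$ iff $M_{ij}\neq0$; cell $ij$ corresponds to edge $ij'$. A partial multiplication matrix is a gridding matrix with fixed $c_i,r_j\in\{\pm1\}$ such that $M_{ij}=c_ir_j$ whenever $M_{ij}\ne 0$; column $i$ is oriented left-to-right if $c_i=1$ and right-to-left otherwise, row $j$ bottom-to-top if $r_j=1$ and top-to-bottom otherwise. The orientation digraph of an $M$-gridded permutation has the points as vertices and an arc $x\to y$ whenever $x,y$ share a column (resp. row) and $x$ precedes $y$ in its orientation. For a cycle of $G_M$ of length $\ell$, a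 gridded $M$-coil defined on that cycle is an $M$-gridded permutation with $n>\ell$ points, an ordering $v_1,\dots,v_n$ of its points and a labelling $1,\dots,\ell$ of the cells corresponding to the edges of the cycle, such that (C1) $v_i$ lies in cell $i\bmod\ell$ (residues in $\{1,\dots,\ell\}$); (C2) $v_{i-1}\to v_i$ for $1<i\le n$; (C3) $v_i\to v_{i-\ell-1}$ for $\ell+1<i\le n$; (C4) $v_{\ell+1}\to v_1$. -}

module Defs where

open import Data.Nat as ℕ using (ℕ; zero; suc; _+_; _*_; _∸_; NonZero; >-nonZero)
open import Data.Nat.DivMod using (_mod_)
open import Data.Nat.Properties using (≤-trans; m≤m+n)
open import Data.Fin as Fin using (Fin; toℕ)
open import Data.Fin.Properties using () renaming (_≟_ to _≟ᶠ_)
open import Data.Fin.Permutation using (Permutation′; _⟨$⟩ʳ_)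
open import Data.Integer as ℤ using (ℤ; 0ℤ; 1ℤ; -1ℤ; _◃_)
open import Data.Sign as Sign using (Sign)
open import Data.Product using (_×_; _,_; ∃; ∃-syntax)
open import Relation.Nullary.Decidable.Core using () renaming (_×-dec_ to _×?_)
open import Data.Sum using (_⊎_)
open import Data.List using (List; length; filter; map)
open import Data.Nat.ListAction using (sum)
open import Data.Fin.Base using () renaming (_<_ to _<ᶠ_; _≤_ to _≤ᶠ_)
open import Function.Definitions using (Injective; Bijective)
open import Relation.Binary.PropositionalEquality using (_≡_; _≢_)
open import Relation.Nullary using (yes; no; Dec)
open import Data.List using (allFin)

-- Partial multiplication matrices.
-- M i j : column i (0-based, from the left), row j (0-based, from the bottom).
-- Entries lie in {0,1,-1}; nonzero entries equal c i * r j.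

record PMM (m n : ℕ) : Set where
  field
    M       : Fin m → Fin n → ℤ
    c       : Fin m → Sign
    r       : Fin n → Sign
    entries : ∀ i j → M i j ≡ 0ℤ ⊎ M i j ≡ (c i Sign.* r j) ◃ 1

Cell : ℕ → ℕ → Set
Cell m n = Fin m × Fin n

-- A point is a position x : Fin N, plotted at (x , π x).
-- A gridding (vertical/horizontal lines placed between points) is
-- determined by the column of each position and the row of each value,
-- both weakly increasing.

module _ {m n : ℕ} (P : PMM m n) {N : ℕ} (π : Permutation′ N) where
  open PMM P

  record Gridding : Set where
    field
      col      : Fin N → Fin m
      row      : Fin N → Fin n
      col-mono : ∀ {x y} → x ≤ᶠ y → col x ≤ᶠ col y
      row-mono : ∀ {u v} → u ≤ᶠ v → row u ≤ᶠ row v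
      nonempty-ok : ∀ x → M (col x) (row (π ⟨$⟩ʳ x)) ≢ 0ℤ
      incr : ∀ x y → col x ≡ col y → row (π ⟨$⟩ʳ x) ≡ row (π ⟨$⟩ʳ y) →
             M (col x) (row (π ⟨$⟩ʳ x)) ≡ 1ℤ → x <ᶠ y → (π ⟨$⟩ʳ x) <ᶠ (π ⟨$⟩ʳ y)
      decr : ∀ x y → col x ≡ col y → row (π ⟨$⟩ʳ x) ≡ row (π ⟨$⟩ʳ y) →
             M (col x) (row (π ⟨$⟩ʳ x)) ≡ -1ℤ → x <ᶠ y → (π ⟨$⟩ʳ y) <ᶠ (π ⟨$⟩ʳ x)

  module _ (g : Gridding) where
    open Gridding g

    cellOf : Fin N → Cell m n
    cellOf x = col x , row (π ⟨$⟩ʳ x)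

    Prec : ∀ {k} → Sign → Fin k → Fin k → Set
    Prec Sign.+ a b = a <ᶠ b
    Prec Sign.- a b = b <ᶠ a

    Arc : Fin N → Fin N → Set
    Arc x y = (col x ≡ col y × Prec (c (col x)) x y)
            ⊎ (row (π ⟨$⟩ʳ x) ≡ row (π ⟨$⟩ʳ y) ×
               Prec (r (row (π ⟨$⟩ʳ x))) (π ⟨$⟩ʳ x) (π ⟨$⟩ʳ y))

    cellCount : Fin m → Fin n → ℕ
    cellCount i j = length (filter (λ x → (col x ≟ᶠ i) ×? (row (π ⟨$⟩ʳ x) ≟ᶠ j)) (allFin N))

    rowOthers : Fin m → Fin n → ℕ
    rowOthers i j = sum (map (λ i′ → sumIf (i′ ≟ᶠ i) (cellCount i′ j)) (allFin m))
      where
      sumIf : ∀ {A : Set} → Dec A → ℕ → ℕ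
      sumIf (yes _) _ = 0
      sumIf (no _)  k = k

    colOthers : Fin m → Fin n → ℕ
    colOthers i j = sum (map (λ j′ → sumIf (j′ ≟ᶠ j) (cellCount i j′)) (allFin n))
      where
      sumIf : ∀ {A : Set} → Dec A → ℕ → ℕ
      sumIf (yes _) _ = 0
      sumIf (no _)  k = k

-- A cycle of length ℓ = 2k (k ≥ 2) visits distinct columns a 0 .. a (k-1)
-- and distinct rows b 0 .. b (k-1) in the order
--   a 0, b 0, a 1, b 1, ..., a (k-1), b (k-1), a 0;
-- its edges (= cells) are (a t , b t) and (a (t+1 mod k) , b t).

module _ {m n : ℕ} (P : PMM m n) where
  open PMM P

  record Cycle : Set where
    field
      k    : ℕ
      2≤k  : 2 ℕ.≤ k
      a    : Fin k → Fin m
      b    : Fin k → Fin n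
      a-inj : Injective _≡_ _≡_ a
      b-inj : Injective _≡_ _≡_ b

    instance
      k-nonZero : NonZero k
      k-nonZero = >-nonZero (≤-trans (ℕ.s≤s ℕ.z≤n) 2≤k)

    next : Fin k → Fin k
    next t = (suc (toℕ t)) mod k

    field
      edge₁ : ∀ t → M (a t) (b t) ≢ 0ℤ
      edge₂ : ∀ t → M (a (next t)) (b t) ≢ 0ℤ

    len : ℕ
    len = 2 * k

    IsEdge : Cell m n → Set
    IsEdge (i , j) = ∃[ t ] ((i ≡ a t × j ≡ b t) ⊎ (i ≡ a (next t) × j ≡ b t))

-- Gridded M-coils (0-based indices: v_i of the paper is ord (i-1),
-- the cell labelled i is lab (i-1)).

module _ {m n : ℕ} (P : PMM m n) {N : ℕ} (π : Permutation′ N)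
         (g : Gridding P π) (C : Cycle P) where
  open Cycle C

  record Coil : Set where
    field
      ℓ<N      : len ℕ.< N
      lab      : Fin len → Cell m n
      lab-inj  : Injective _≡_ _≡_ lab
      lab-edge : ∀ t → IsEdge (lab t)
      lab-onto : ∀ e → IsEdge e → ∃[ t ] lab t ≡ e
      ord      : Fin N → Fin N
      ord-bij  : Bijective _≡_ _≡_ ord

    instance
      len-nonZero : NonZero len
      len-nonZero = >-nonZero (≤-trans (ℕ.s≤s ℕ.z≤n) (≤-trans 2≤k (m≤m+n k (k + 0))))

    field
      C1 : ∀ i → cellOf P π g (ord i) ≡ lab (toℕ i mod len)
      C2 : ∀ i j → toℕ j ≡ suc (toℕ i) → Arc P π g (ord i) (ord j)
      C3 : ∀ i j → toℕ i ≡ toℕ j + len + 1 → Arc P π g (ord i) (ord j)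
      C4 : ∀ i j → toℕ i ≡ len → toℕ j ≡ 0 → Arc P π g (ord i) (ord j)

module Submission where

-- Write V 0, V 1, … for the points of the coil in its order.  V s and V (s + ℓ) lie in one cell of
-- the coil gridding, and V (s + ℓ) precedes V s in its column: the arcs V (s + ℓ) → V (s - 1) → V s
-- (C3, C2), or the arc C4 when s = 0, form a detour that runs along a single row or column.
-- Hence, in any other gridding, the indices of the points of a cell in one residue class mod ℓ form
-- a run s, s + ℓ, …, s + tℓ, so at most ℓ points V s of the cell have V (s + ℓ) outside it.
-- For the others, V (s + ℓ) is in the cell too and, unless s = 0 or s + ℓ + 1 = N, there are two
-- detours from V (s + ℓ) to V s, through V (s - 1) and through V (s + ℓ + 1).  These two points and
-- V s lie in distinct cells of the cycle, and a column (row) of G_M meets the cycle in only two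
-- cells, so one detour runs along a row (column); its middle point then lies in the row (column) of
-- the cell in the other gridding, but outside the cell.  Each such point serves at most two values
-- of s, whence k ≤ ℓ + 2 + 2S ≤ 2ℓ(S + 1).

open import Defs
open import Data.Nat using (ℕ; _+_; _*_; _<_; _≤_)
open import Data.Product using (_×_)
open import Data.Fin.Permutation using (Permutation′)

open import Data.Bool using (Bool; true; false)
open import Data.Empty using (⊥; ⊥-elim)
open import Data.Fin as Fin using (Fin; toℕ)
open import Data.Fin.Properties as FinP using (toℕ-injective; toℕ-fromℕ<)
open import Data.Fin.Permutation using (_⟨$⟩ʳ_)
open import Data.Integer using (_◃_)
open import Data.List using (List; []; _∷_; _++_; length; filter; map; concat; allFin; upTo)
open import Data.List.Membership.Propositional using (_∈_)
open import Data.List.Membership.Propositional.Properties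
  using (∈-∃++; ∈-++⁻; ∈-++⁺ˡ; ∈-++⁺ʳ; ∈-map⁺; ∈-filter⁺; ∈-concat⁺′; ∈-upTo⁺; ∈-allFin)
open import Data.List.Properties using (length-++; length-++-sucʳ; length-map; length-upTo)
open import Data.List.Relation.Unary.All using (lookup)
open import Data.List.Relation.Unary.AllPairs using (_∷_)
open import Data.List.Relation.Unary.Any using (here; there)
open import Data.List.Relation.Unary.Unique.Propositional using (Unique)
open import Data.List.Relation.Unary.Unique.Propositional.Properties using (allFin⁺)
open import Data.Nat.DivMod using (_mod_; _%_; _/_; m%n<n; m≡m%n+[m/n]*n; /-monoˡ-≤; m<n⇒m%n≡m; [m+n]%n≡m%n)
open import Data.Nat.ListAction using (sum)
open import Data.Nat.Tactic.RingSolver using (solve-∀)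
open import Data.Nat as ℕ using (zero; suc; NonZero)
import Data.Nat.Properties as ℕP
open import Data.Product using (Σ; ∃-syntax; _,_; proj₁; proj₂)
open import Data.Product.Properties using (×-≡,≡→≡; ≡-dec)
open import Data.Sign as Sign using (Sign)
open import Data.Sign.Properties using (opposite-involutive)
open import Data.Sum using (_⊎_; inj₁; inj₂; [_,_])
open import Function.Definitions using (Injective)
open import Relation.Binary.Definitions using (tri<; tri≈; tri>)
open import Relation.Binary.PropositionalEquality
  using (_≡_; _≢_; refl; sym; trans; cong; cong₂; subst; module ≡-Reasoning)
open import Relation.Nullary using (¬_; Dec; yes; no; contradiction)
open import Relation.Nullary.Decidable using (¬?; _×-dec_)
open import Relation.Unary using (Decidable)

infix 4 _<[_]_

_<[_]_ : ∀ {k} → Fin k → Sign → Fin k → Set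
a <[ Sign.+ ] b = a Fin.< b
a <[ Sign.- ] b = b Fin.< a

module _ {k : ℕ} where

  <[]-trans : ∀ σ {a b c : Fin k} → a <[ σ ] b → b <[ σ ] c → a <[ σ ] c
  <[]-trans Sign.+ a<b b<c = FinP.<-trans a<b b<c
  <[]-trans Sign.- b<a c<b = FinP.<-trans c<b b<a

  <[]-irrefl : ∀ σ {a : Fin k} → ¬ a <[ σ ] a
  <[]-irrefl Sign.+ = FinP.<-irrefl refl
  <[]-irrefl Sign.- = FinP.<-irrefl refl

  <[]-opposite : ∀ σ {a b : Fin k} → b <[ σ ] a → a <[ Sign.opposite σ ] b
  <[]-opposite Sign.+ b<a = b<a
  <[]-opposite Sign.- a<b = a<b

  <[]-connex : ∀ σ {a b : Fin k} → a ≢ b → a <[ σ ] b ⊎ b <[ σ ] a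
  <[]-connex σ {a} {b} a≢b with FinP.<-cmp a b
  <[]-connex Sign.+ a≢b | tri< a<b _ _ = inj₁ a<b
  <[]-connex Sign.- a≢b | tri< a<b _ _ = inj₂ a<b
  <[]-connex σ      a≢b | tri≈ _ a≡b _ = contradiction a≡b a≢b
  <[]-connex Sign.+ a≢b | tri> _ _ b<a = inj₂ b<a
  <[]-connex Sign.- a≢b | tri> _ _ b<a = inj₁ b<a

  monotone-between : ∀ {L} (f : Fin k → Fin L) → (∀ {a b} → a Fin.≤ b → f a Fin.≤ f b) →
                     ∀ σ {a b c} → a <[ σ ] b → b <[ σ ] c → f a ≡ f c → f b ≡ f a
  monotone-between f mono Sign.+ a<b b<c fa≡fc =
    FinP.≤-antisym (subst (f _ Fin.≤_) (sym fa≡fc) (mono (ℕP.<⇒≤ b<c))) (mono (ℕP.<⇒≤ a<b))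
  monotone-between f mono Sign.- b<a c<b fa≡fc =
    FinP.≤-antisym (mono (ℕP.<⇒≤ b<a)) (subst (Fin._≤ f _) (sym fa≡fc) (mono (ℕP.<⇒≤ c<b)))

s*[s*t]≡t : ∀ s t → s Sign.* (s Sign.* t) ≡ t
s*[s*t]≡t Sign.+ t = refl
s*[s*t]≡t Sign.- t = opposite-involutive t

[s*t]*t≡s : ∀ s t → (s Sign.* t) Sign.* t ≡ s
[s*t]*t≡s Sign.+ Sign.+ = refl
[s*t]*t≡s Sign.+ Sign.- = refl
[s*t]*t≡s Sign.- Sign.+ = refl
[s*t]*t≡s Sign.- Sign.- = refl

%-≡⇒≡+* : ∀ {m n} d .{{_ : NonZero d}} → m % d ≡ n % d → m ≤ n → ∃[ q ] n ≡ m + q * d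
%-≡⇒≡+* {m} {n} d m%d≡n%d m≤n = q , (begin
  n                                      ≡⟨ m≡m%n+[m/n]*n n d ⟩
  n % d + n / d * d                      ≡⟨ cong (λ r → r + n / d * d) (sym m%d≡n%d) ⟩
  m % d + n / d * d                      ≡⟨ cong (λ a → m % d + a * d) (sym (ℕP.m+[n∸m]≡n m/d≤n/d)) ⟩
  m % d + (m / d + q) * d                ≡⟨ cong (m % d +_) (ℕP.*-distribʳ-+ d (m / d) q) ⟩
  m % d + (m / d * d + q * d)            ≡⟨ sym (ℕP.+-assoc (m % d) _ _) ⟩
  m % d + m / d * d + q * d              ≡⟨ cong (_+ q * d) (sym (m≡m%n+[m/n]*n m d)) ⟩
  m + q * d                              ∎)
  where
  open ≡-Reasoning
  q : ℕ
  q = n / d ℕ.∸ m / d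
  m/d≤n/d : m / d ≤ n / d
  m/d≤n/d = /-monoˡ-≤ d m≤n

%-injective-window : ∀ {m n} d .{{_ : NonZero d}} → m ≤ n → n < m + d → m % d ≡ n % d → m ≡ n
%-injective-window {m} {n} d m≤n n<m+d m%d≡n%d with %-≡⇒≡+* d m%d≡n%d m≤n
... | zero  , n≡m+0    = sym (trans n≡m+0 (ℕP.+-identityʳ m))
... | suc q , n≡m+d+qd =
  contradiction (subst (_< m + d) n≡m+d+qd n<m+d) (ℕP.≤⇒≯ (ℕP.+-monoʳ-≤ m (ℕP.m≤m+n d (q * d))))

ℓ+2+2S≤2ℓ[R+1] : ∀ {c ℓ S R} → 2 ≤ ℓ → c ≤ ℓ + (2 + (S + S)) → S ≤ R → c ≤ 2 * ℓ * (R + 1)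
ℓ+2+2S≤2ℓ[R+1] {c} {ℓ} {S} {R} 2≤ℓ c≤ S≤R = ℕP.≤-trans c≤ (begin
  ℓ + (2 + (S + S))  ≤⟨ ℕP.+-monoʳ-≤ ℓ (ℕP.+-mono-≤ 2≤ℓ (ℕP.+-mono-≤ S≤R S≤R)) ⟩
  ℓ + (ℓ + (R + R))  ≡⟨ regroup ℓ R ⟩
  2 * ℓ + 2 * R      ≤⟨ ℕP.+-monoʳ-≤ (2 * ℓ) (ℕP.*-monoˡ-≤ R 2≤2ℓ) ⟩
  2 * ℓ + 2 * ℓ * R  ≡⟨ factor ℓ R ⟩
  2 * ℓ * (R + 1)    ∎)
  where
  open ℕP.≤-Reasoning
  2≤2ℓ : 2 ≤ 2 * ℓ
  2≤2ℓ = ℕP.≤-trans 2≤ℓ (ℕP.m≤m+n ℓ (ℓ + 0))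
  regroup : ∀ ℓ R → ℓ + (ℓ + (R + R)) ≡ 2 * ℓ + 2 * R
  regroup = solve-∀
  factor : ∀ ℓ R → 2 * ℓ + 2 * ℓ * R ≡ 2 * ℓ * (R + 1)
  factor = solve-∀

∈-++-∷⁻ : ∀ {B : Set} (ys₁ : List B) {ys₂ u v} → u ∈ ys₁ ++ v ∷ ys₂ → u ≢ v → u ∈ ys₁ ++ ys₂
∈-++-∷⁻ ys₁ u∈ u≢v with ∈-++⁻ ys₁ u∈
... | inj₁ u∈ys₁         = ∈-++⁺ˡ u∈ys₁
... | inj₂ (here u≡v)    = contradiction u≡v u≢v
... | inj₂ (there u∈ys₂) = ∈-++⁺ʳ ys₁ u∈ys₂

module _ {A : Set} {Q : A → Set} (Q? : Decidable Q) where

  injective⇒length-filter≤ : ∀ {B : Set} {xs : List A} (ys : List B) → Unique xs → (f : ∀ x → Q x → B) →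
                             (∀ {x y} qx qy → f x qx ≡ f y qy → x ≡ y) →
                             (∀ {x} → x ∈ xs → (qx : Q x) → f x qx ∈ ys) →
                             length (filter Q? xs) ≤ length ys
  injective⇒length-filter≤ {xs = []}     ys _              f f-inj f∈ = ℕ.z≤n
  injective⇒length-filter≤ {xs = x ∷ xs} ys (x∉xs ∷ uniq) f f-inj f∈ with Q? x
  ... | no  _  = injective⇒length-filter≤ ys uniq f f-inj (λ y∈ → f∈ (there y∈))
  ... | yes qx with ∈-∃++ (f∈ (here refl) qx)
  ...   | ys₁ , ys₂ , refl =
    subst (suc (length (filter Q? xs)) ≤_) (sym (length-++-sucʳ ys₁ (f x qx) ys₂))
      (ℕ.s≤s (injective⇒length-filter≤ (ys₁ ++ ys₂) uniq f f-inj
        (λ y∈ qy → ∈-++-∷⁻ ys₁ (f∈ (there y∈) qy)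
                     (λ fy≡fx → lookup x∉xs y∈ (sym (f-inj qy qx fy≡fx))))))

  length-filter≤sum : ∀ {B : Set} {R : B → A → Set} (R? : ∀ b → Decidable (R b)) (bs : List B) {xs : List A} →
                      Unique xs → (∀ {x} → Q x → ∃[ b ] b ∈ bs × R b x) →
                      length (filter Q? xs) ≤ sum (map (λ b → length (filter (R? b) xs)) bs)
  length-filter≤sum {B} R? bs {xs} uniq cover =
    ℕP.≤-trans (injective⇒length-filter≤ (concat (map fibre bs)) uniq (λ x _ → x) (λ _ _ x≡y → x≡y)
                  (λ x∈ qx → let b , b∈bs , rbx = cover qx in
                             ∈-concat⁺′ (∈-filter⁺ (R? b) x∈ rbx) (∈-map⁺ fibre b∈bs)))
               (ℕP.≤-reflexive (length-concat bs))
    where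
    fibre : B → List A
    fibre b = filter (R? b) xs

    length-concat : ∀ bs → length (concat (map fibre bs)) ≡ sum (map (λ b → length (fibre b)) bs)
    length-concat []       = refl
    length-concat (b ∷ bs) = trans (length-++ (fibre b)) (cong (length (fibre b) +_) (length-concat bs))

Skip : Set₁
Skip = ∀ {A : Set} → Dec A → ℕ → ℕ

record IsSkip (skip : Skip) : Set₁ where
  field
    skip-no  : ∀ {A : Set} (¬a : ¬ A) k → skip (no ¬a) k ≡ k
    skip-yes : ∀ {A : Set} (a : A) k → skip (yes a) k ≡ 0

sum-skip≡sum-filter : ∀ {K} {skip : Skip} → IsSkip skip → (i : Fin K) (f : Fin K → ℕ) (is : List (Fin K)) →
                      sum (map (λ i′ → skip (i′ FinP.≟ i) (f i′)) is)
                        ≡ sum (map f (filter (λ i′ → ¬? (i′ FinP.≟ i)) is))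
sum-skip≡sum-filter skips i f []       = refl
sum-skip≡sum-filter skips i f (i′ ∷ is) with i′ FinP.≟ i
... | yes i′≡i = cong₂ _+_ (IsSkip.skip-yes skips i′≡i (f i′)) (sum-skip≡sum-filter skips i f is)
... | no  i′≢i = cong₂ _+_ (IsSkip.skip-no skips i′≢i (f i′)) (sum-skip≡sum-filter skips i f is)

-- The summands of rowOthers and colOthers go through a helper local to their definitions;
-- abstracting the first summand's decision lets pattern unification recover that helper.

rowOthers≡sum : ∀ {m n N} (P : PMM m n) (π : Permutation′ N) (g : Gridding P π) i j →
                rowOthers P π g i j
                  ≡ sum (map (λ i′ → cellCount P π g i′ j) (filter (λ i′ → ¬? (i′ FinP.≟ i)) (allFin m)))
rowOthers≡sum {zero}  P π g () j
rowOthers≡sum {suc m} P π g i j =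
  let _ , rowOthers≡ , skips = captured in
  trans rowOthers≡ (sum-skip≡sum-filter skips i (λ i′ → cellCount P π g i′ j) (allFin (suc m)))
  where
  captured : Σ Skip λ skip →
               rowOthers P π g i j ≡ sum (map (λ i′ → skip (i′ FinP.≟ i) (cellCount P π g i′ j)) (allFin (suc m)))
               × IsSkip skip
  captured with Fin.zero ≡ i | Fin.zero FinP.≟ i | cellCount P π g Fin.zero j
  ... | _ | _ | _ = _ , refl , record { skip-no = λ _ _ → refl ; skip-yes = λ _ _ → refl }

colOthers≡sum : ∀ {m n N} (P : PMM m n) (π : Permutation′ N) (g : Gridding P π) i j →
                colOthers P π g i j
                  ≡ sum (map (λ j′ → cellCount P π g i j′) (filter (λ j′ → ¬? (j′ FinP.≟ j)) (allFin n)))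
colOthers≡sum {n = zero}  P π g i ()
colOthers≡sum {n = suc n} P π g i j =
  let _ , colOthers≡ , skips = captured in
  trans colOthers≡ (sum-skip≡sum-filter skips j (λ j′ → cellCount P π g i j′) (allFin (suc n)))
  where
  captured : Σ Skip λ skip →
               colOthers P π g i j ≡ sum (map (λ j′ → skip (j′ FinP.≟ j) (cellCount P π g i j′)) (allFin (suc n)))
               × IsSkip skip
  captured with Fin.zero ≡ j | Fin.zero FinP.≟ j | cellCount P π g i Fin.zero
  ... | _ | _ | _ = _ , refl , record { skip-no = λ _ _ → refl ; skip-yes = λ _ _ → refl }

-- Cells of a gridding

module _ {m n : ℕ} {P : PMM m n} {N : ℕ} {π : Permutation′ N} where
  open PMM P

  colOf : Gridding P π → Fin N → Fin m
  colOf h x = proj₁ (cellOf P π h x)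

  rowOf : Gridding P π → Fin N → Fin n
  rowOf h x = proj₂ (cellOf P π h x)

  SameCell : Gridding P π → Fin N → Fin N → Set
  SameCell h x y = cellOf P π h x ≡ cellOf P π h y

  cellSign : Gridding P π → Fin N → Sign
  cellSign h x = c (colOf h x) Sign.* r (rowOf h x)

  cellSign-cong : ∀ h {x y} → SameCell h x y → cellSign h x ≡ cellSign h y
  cellSign-cong h x∼y = cong (λ cell → c (proj₁ cell) Sign.* r (proj₂ cell)) x∼y

  cell-order : ∀ h {x y} → SameCell h x y → x Fin.< y → π ⟨$⟩ʳ x <[ cellSign h x ] π ⟨$⟩ʳ y
  cell-order h {x} {y} x∼y x<y with entries (colOf h x) (rowOf h x)
  ... | inj₁ M≡0   = contradiction M≡0 (Gridding.nonempty-ok h x)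
  ... | inj₂ M≡s◃1 = by-sign (cellSign h x) M≡s◃1
    where
    by-sign : ∀ σ → M (colOf h x) (rowOf h x) ≡ σ ◃ 1 → π ⟨$⟩ʳ x <[ σ ] π ⟨$⟩ʳ y
    by-sign Sign.+ M≡1  = Gridding.incr h x y (cong proj₁ x∼y) (cong proj₂ x∼y) M≡1 x<y
    by-sign Sign.- M≡-1 = Gridding.decr h x y (cong proj₁ x∼y) (cong proj₂ x∼y) M≡-1 x<y

  positions⇒values : ∀ h σ {x y} → SameCell h x y → x <[ σ ] y →
                     π ⟨$⟩ʳ x <[ σ Sign.* cellSign h x ] π ⟨$⟩ʳ y
  positions⇒values h Sign.+ x∼y x<y = cell-order h x∼y x<y
  positions⇒values h Sign.- {x} {y} x∼y y<x = <[]-opposite (cellSign h x)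
    (subst (λ s → π ⟨$⟩ʳ y <[ s ] π ⟨$⟩ʳ x) (cellSign-cong h (sym x∼y)) (cell-order h (sym x∼y) y<x))

  values⇒positions : ∀ h σ {x y} → SameCell h x y →
                     π ⟨$⟩ʳ x <[ σ Sign.* cellSign h x ] π ⟨$⟩ʳ y → x <[ σ ] y
  values⇒positions h σ {x} {y} x∼y πx<πy with x FinP.≟ y
  ... | yes refl = contradiction πx<πy (<[]-irrefl (σ Sign.* cellSign h x))
  ... | no  x≢y with <[]-connex σ x≢y
  ...   | inj₁ x<y = x<y
  ...   | inj₂ y<x = contradiction (<[]-trans τ πx<πy πy<πx) (<[]-irrefl τ)
    where
    τ : Sign
    τ = σ Sign.* cellSign h x
    πy<πx : π ⟨$⟩ʳ y <[ τ ] π ⟨$⟩ʳ x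
    πy<πx = subst (λ s → π ⟨$⟩ʳ y <[ σ Sign.* s ] π ⟨$⟩ʳ x) (cellSign-cong h (sym x∼y))
              (positions⇒values h σ (sym x∼y) y<x)

  -- Inside a cell, row and column orientations agree because the cell's sign is their product.
  row-order⇒column-order : ∀ h {x y} → SameCell h x y →
                           π ⟨$⟩ʳ x <[ r (rowOf h x) ] π ⟨$⟩ʳ y → x <[ c (colOf h x) ] y
  row-order⇒column-order h {x} {y} x∼y πx<πy = values⇒positions h (c (colOf h x)) x∼y
    (subst (λ s → π ⟨$⟩ʳ x <[ s ] π ⟨$⟩ʳ y) (sym (s*[s*t]≡t (c (colOf h x)) (r (rowOf h x)))) πx<πy)

  fromPrec : ∀ h σ {k} {a b : Fin k} → Prec P π h σ a b → a <[ σ ] b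
  fromPrec h Sign.+ a<b = a<b
  fromPrec h Sign.- b<a = b<a

  arc-within-cell : ∀ h {x y} → SameCell h x y → Arc P π h x y → x <[ c (colOf h y) ] y
  arc-within-cell h {x} {y} x∼y (inj₁ (col≡ , x<y)) = subst (λ i → x <[ c i ] y) col≡ (fromPrec h _ x<y)
  arc-within-cell h {x} {y} x∼y (inj₂ (_ , πx<πy)) =
    subst (λ i → x <[ c i ] y) (cong proj₁ x∼y) (row-order⇒column-order h x∼y (fromPrec h _ πx<πy))

  data Detour (h : Gridding P π) (p w q : Fin N) : Set where
    along-column : colOf h w ≡ colOf h q → p <[ c (colOf h q) ] w → w <[ c (colOf h q) ] q → Detour h p w q
    along-row    : rowOf h w ≡ rowOf h q →
                   π ⟨$⟩ʳ p <[ r (rowOf h q) ] π ⟨$⟩ʳ w → π ⟨$⟩ʳ w <[ r (rowOf h q) ] π ⟨$⟩ʳ q →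
                   Detour h p w q

  detour : ∀ h {p w q} → SameCell h p q → ¬ SameCell h w q → Arc P π h p w → Arc P π h w q → Detour h p w q
  detour h {p} {w} {q} p∼q w≁q (inj₁ (col-pw , p<w)) (inj₁ (col-wq , w<q)) =
    along-column col-wq (subst (λ i → p <[ c i ] w) (cong proj₁ p∼q) (fromPrec h _ p<w))
                        (subst (λ i → w <[ c i ] q) col-wq (fromPrec h _ w<q))
  detour h {p} {w} {q} p∼q w≁q (inj₂ (row-pw , p<w)) (inj₂ (row-wq , w<q)) =
    along-row row-wq (subst (λ j → π ⟨$⟩ʳ p <[ r j ] π ⟨$⟩ʳ w) (cong proj₂ p∼q) (fromPrec h _ p<w))
                     (subst (λ j → π ⟨$⟩ʳ w <[ r j ] π ⟨$⟩ʳ q) row-wq (fromPrec h _ w<q))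
  detour h p∼q w≁q (inj₁ (col-pw , _)) (inj₂ (row-wq , _)) =
    contradiction (×-≡,≡→≡ (trans (sym col-pw) (cong proj₁ p∼q) , row-wq)) w≁q
  detour h p∼q w≁q (inj₂ (row-pw , _)) (inj₁ (col-wq , _)) =
    contradiction (×-≡,≡→≡ (col-wq , trans (sym row-pw) (cong proj₂ p∼q))) w≁q

  detour-precedes : ∀ h {p w q} → SameCell h p q → Detour h p w q → p <[ c (colOf h q) ] q
  detour-precedes h p∼q (along-column _ p<w w<q) = <[]-trans _ p<w w<q
  detour-precedes h {p} {w} {q} p∼q (along-row _ p<w w<q) =
    subst (λ i → p <[ c i ] q) (cong proj₁ p∼q)
      (row-order⇒column-order h p∼q
        (subst (λ j → π ⟨$⟩ʳ p <[ r j ] π ⟨$⟩ʳ q) (sym (cong proj₂ p∼q)) (<[]-trans _ p<w w<q)))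

  cell-convex : ∀ h g σ {x y z} → SameCell h x y → SameCell h y z → x <[ σ ] y → y <[ σ ] z →
                SameCell g x z → SameCell g y x
  cell-convex h g σ {x} {y} {z} x∼y y∼z x<y y<z gx∼z = ×-≡,≡→≡
    ( monotone-between (Gridding.col g) (Gridding.col-mono g) σ x<y y<z (cong proj₁ gx∼z)
    , monotone-between (Gridding.row g) (Gridding.row-mono g) (σ Sign.* cellSign h x)
        (positions⇒values h σ x∼y x<y)
        (subst (λ s → π ⟨$⟩ʳ y <[ σ Sign.* s ] π ⟨$⟩ʳ z) (cellSign-cong h (sym x∼y))
          (positions⇒values h σ y∼z y<z))
        (cong proj₂ gx∼z) )

  cell-convex-values : ∀ h g σ {x y z} → SameCell h x y → SameCell h y z →
                       π ⟨$⟩ʳ x <[ σ ] π ⟨$⟩ʳ y → π ⟨$⟩ʳ y <[ σ ] π ⟨$⟩ʳ z →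
                       SameCell g x z → SameCell g y x
  cell-convex-values h g σ {x} {y} {z} x∼y y∼z πx<πy πy<πz =
    cell-convex h g τ x∼y y∼z (values⇒positions h τ x∼y (cancel πx<πy))
      (values⇒positions h τ y∼z
        (subst (λ s → π ⟨$⟩ʳ y <[ τ Sign.* s ] π ⟨$⟩ʳ z) (cellSign-cong h x∼y) (cancel πy<πz)))
    where
    τ : Sign
    τ = σ Sign.* cellSign h x
    cancel : ∀ {a b} → a <[ σ ] b → a <[ τ Sign.* cellSign h x ] b
    cancel {a} {b} = subst (λ s → a <[ s ] b) (sym ([s*t]*t≡s σ (cellSign h x)))

  between-values⇒same-row-other-column :
    ∀ h g ρ {p w q} → SameCell h p q → ¬ SameCell h w q → SameCell g p q →
    π ⟨$⟩ʳ p <[ ρ ] π ⟨$⟩ʳ w → π ⟨$⟩ʳ w <[ ρ ] π ⟨$⟩ʳ q →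
    rowOf g w ≡ rowOf g q × colOf g w ≢ colOf g q
  between-values⇒same-row-other-column h g ρ {p} {w} {q} p∼q w≁q gp∼q p<w w<q = row-w≡row-q , λ col-w≡col-q →
    let gw∼q = ×-≡,≡→≡ (col-w≡col-q , row-w≡row-q) in
    w≁q (trans (cell-convex-values g h ρ (trans gp∼q (sym gw∼q)) gw∼q p<w w<q p∼q) p∼q)
    where
    row-w≡row-q : rowOf g w ≡ rowOf g q
    row-w≡row-q = trans (monotone-between (Gridding.row g) (Gridding.row-mono g) ρ p<w w<q (cong proj₂ gp∼q))
                        (cong proj₂ gp∼q)

  between-positions⇒same-column-other-row :
    ∀ h g κ {p w q} → SameCell h p q → ¬ SameCell h w q → SameCell g p q →
    p <[ κ ] w → w <[ κ ] q → colOf g w ≡ colOf g q × rowOf g w ≢ rowOf g q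
  between-positions⇒same-column-other-row h g κ {p} {w} {q} p∼q w≁q gp∼q p<w w<q = col-w≡col-q , λ row-w≡row-q →
    let gw∼q = ×-≡,≡→≡ (col-w≡col-q , row-w≡row-q) in
    w≁q (trans (cell-convex g h κ (trans gp∼q (sym gw∼q)) gw∼q p<w w<q p∼q) p∼q)
    where
    col-w≡col-q : colOf g w ≡ colOf g q
    col-w≡col-q = trans (monotone-between (Gridding.col g) (Gridding.col-mono g) κ p<w w<q (cong proj₁ gp∼q))
                        (cong proj₁ gp∼q)

-- Cycles of the row-column graph

two-of-three-agree : (x y z : Bool) → x ≡ y ⊎ x ≡ z ⊎ y ≡ z
two-of-three-agree true  true  _     = inj₁ refl
two-of-three-agree false false _     = inj₁ refl
two-of-three-agree true  false true  = inj₂ (inj₁ refl)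
two-of-three-agree true  false false = inj₂ (inj₂ refl)
two-of-three-agree false true  true  = inj₂ (inj₂ refl)
two-of-three-agree false true  false = inj₂ (inj₁ refl)

module _ {m n : ℕ} {P : PMM m n} (C : Cycle P) where
  open Cycle C

  next-injective-≤ : ∀ {t t′} → toℕ t ≤ toℕ t′ → next t ≡ next t′ → t ≡ t′
  next-injective-≤ {t} {t′} t≤t′ next≡ = toℕ-injective (ℕP.suc-injective
    (%-injective-window k (ℕ.s≤s t≤t′) (ℕP.≤-<-trans (FinP.toℕ<n t′) (ℕ.s≤s (ℕP.m≤n+m k (toℕ t))))
      (trans (sym (toℕ-fromℕ< _)) (trans (cong toℕ next≡) (toℕ-fromℕ< _)))))

  next-injective : Injective _≡_ _≡_ next
  next-injective {t} {t′} next≡ with ℕP.≤-total (toℕ t) (toℕ t′)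
  ... | inj₁ t≤t′ = next-injective-≤ t≤t′ next≡
  ... | inj₂ t′≤t = sym (next-injective-≤ t′≤t (sym next≡))

  kind : ∀ {e} → IsEdge e → Bool
  kind (_ , inj₁ _) = true
  kind (_ , inj₂ _) = false

  KindSeparates : ∀ {X : Set} → (Cell m n → X) → Set
  KindSeparates L = ∀ {e e′} (p : IsEdge e) (p′ : IsEdge e′) → kind p ≡ kind p′ → L e ≡ L e′ → e ≡ e′

  column-separates : KindSeparates proj₁
  column-separates (_ , inj₁ (i≡ , j≡)) (_ , inj₁ (i′≡ , j′≡)) _ i≡i′
    with a-inj (trans (sym i≡) (trans i≡i′ i′≡))
  ... | refl = ×-≡,≡→≡ (i≡i′ , trans j≡ (sym j′≡))
  column-separates (_ , inj₂ (i≡ , j≡)) (_ , inj₂ (i′≡ , j′≡)) _ i≡i′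
    with next-injective (a-inj (trans (sym i≡) (trans i≡i′ i′≡)))
  ... | refl = ×-≡,≡→≡ (i≡i′ , trans j≡ (sym j′≡))
  column-separates (_ , inj₁ _) (_ , inj₂ _) () _
  column-separates (_ , inj₂ _) (_ , inj₁ _) () _

  row-separates : KindSeparates proj₂
  row-separates (_ , inj₁ (i≡ , j≡)) (_ , inj₁ (i′≡ , j′≡)) _ j≡j′
    with b-inj (trans (sym j≡) (trans j≡j′ j′≡))
  ... | refl = ×-≡,≡→≡ (trans i≡ (sym i′≡) , j≡j′)
  row-separates (_ , inj₂ (i≡ , j≡)) (_ , inj₂ (i′≡ , j′≡)) _ j≡j′
    with b-inj (trans (sym j≡) (trans j≡j′ j′≡))
  ... | refl = ×-≡,≡→≡ (trans i≡ (sym i′≡) , j≡j′)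
  row-separates (_ , inj₁ _) (_ , inj₂ _) () _
  row-separates (_ , inj₂ _) (_ , inj₁ _) () _

  at-most-two-on-a-line : ∀ {X : Set} {L : Cell m n → X} → KindSeparates L →
                          ∀ {e₁ e₂ e₃} → IsEdge e₁ → IsEdge e₂ → IsEdge e₃ →
                          L e₁ ≡ L e₃ → L e₂ ≡ L e₃ → e₁ ≡ e₂ ⊎ e₁ ≡ e₃ ⊎ e₂ ≡ e₃
  at-most-two-on-a-line separates p₁ p₂ p₃ L₁≡L₃ L₂≡L₃ with two-of-three-agree (kind p₁) (kind p₂) (kind p₃)
  ... | inj₁ k₁≡k₂        = inj₁ (separates p₁ p₂ k₁≡k₂ (trans L₁≡L₃ (sym L₂≡L₃)))
  ... | inj₂ (inj₁ k₁≡k₃) = inj₂ (inj₁ (separates p₁ p₃ k₁≡k₃ L₁≡L₃))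
  ... | inj₂ (inj₂ k₂≡k₃) = inj₂ (inj₂ (separates p₂ p₃ k₂≡k₃ L₂≡L₃))

-- The points of a coil

module OnCoil {m n N : ℕ} {P : PMM m n} {C : Cycle P} {π : Permutation′ N} {g♮ : Gridding P π}
              (K : Coil P π g♮ C) where
  open PMM P
  open Cycle C
  open Coil K

  ℓ : ℕ
  ℓ = len

  2<ℓ : 2 < ℓ
  2<ℓ = ℕP.+-mono-≤ 2≤k (ℕP.≤-trans (ℕ.s≤s ℕ.z≤n) (ℕP.≤-trans 2≤k (ℕP.m≤m+n k 0)))

  1<ℓ : 1 < ℓ
  1<ℓ = ℕP.<-trans (ℕ.s≤s (ℕ.s≤s ℕ.z≤n)) 2<ℓ

  instance
    N-nonZero : NonZero N
    N-nonZero = ℕ.>-nonZero (ℕP.≤-<-trans ℕ.z≤n ℓ<N)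

  -- V s is the paper's v_(s+1); it wraps around for s ≥ N, hence the bounds s < N below.
  V : ℕ → Fin N
  V s = ord (s mod N)

  toℕ-mod : ∀ {s} → s < N → toℕ (s mod N) ≡ s
  toℕ-mod s<N = trans (toℕ-fromℕ< _) (m<n⇒m%n≡m s<N)

  index : Fin N → ℕ
  index x = toℕ (proj₁ (proj₂ ord-bij x))

  index<N : ∀ x → index x < N
  index<N x = FinP.toℕ<n (proj₁ (proj₂ ord-bij x))

  V-index : ∀ x → V (index x) ≡ x
  V-index x = trans (cong ord (toℕ-injective (toℕ-mod (index<N x)))) (proj₂ (proj₂ ord-bij x) refl)

  index-injective : ∀ {x y} → index x ≡ index y → x ≡ y
  index-injective {x} {y} eq = trans (sym (V-index x)) (trans (cong V eq) (V-index y))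

  V-injective : ∀ {s s′} → s < N → s′ < N → V s ≡ V s′ → s ≡ s′
  V-injective s<N s′<N eq = trans (sym (toℕ-mod s<N)) (trans (cong toℕ (proj₁ ord-bij eq)) (toℕ-mod s′<N))

  cell≡lab : ∀ {s} → s < N → cellOf P π g♮ (V s) ≡ lab (s mod ℓ)
  cell≡lab {s} s<N = trans (C1 (s mod N)) (cong (λ t → lab (t mod ℓ)) (toℕ-mod s<N))

  edge-V : ∀ {s} → s < N → IsEdge (cellOf P π g♮ (V s))
  edge-V s<N = subst IsEdge (sym (cell≡lab s<N)) (lab-edge _)

  same-residue⇒same-cell : ∀ {s s′} → s < N → s′ < N → s % ℓ ≡ s′ % ℓ → SameCell g♮ (V s) (V s′)
  same-residue⇒same-cell s<N s′<N res = trans (cell≡lab s<N)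
    (trans (cong lab (toℕ-injective (trans (toℕ-fromℕ< _) (trans res (sym (toℕ-fromℕ< _))))))
           (sym (cell≡lab s′<N)))

  same-cell⇒same-residue : ∀ {s s′} → s < N → s′ < N → SameCell g♮ (V s) (V s′) → s % ℓ ≡ s′ % ℓ
  same-cell⇒same-residue s<N s′<N same = trans (sym (toℕ-fromℕ< _))
    (trans (cong toℕ (lab-inj (trans (sym (cell≡lab s<N)) (trans same (cell≡lab s′<N))))) (toℕ-fromℕ< _))

  period-cell : ∀ s → s + ℓ < N → SameCell g♮ (V (s + ℓ)) (V s)
  period-cell s b = same-residue⇒same-cell b (ℕP.≤-<-trans (ℕP.m≤m+n s ℓ) b) ([m+n]%n≡m%n s ℓ)

  cells-distinct : ∀ t s → 0 < t → t < ℓ → t + s < N → ¬ SameCell g♮ (V s) (V (t + s))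
  cells-distinct t s 0<t t<ℓ b same = ℕP.<⇒≢ (ℕP.m<n+m s 0<t)
    (%-injective-window ℓ (ℕP.m≤n+m s t) (subst (_< s + ℓ) (ℕP.+-comm s t) (ℕP.+-monoʳ-< s t<ℓ))
      (same-cell⇒same-residue (ℕP.≤-<-trans (ℕP.m≤n+m s t) b) b same))

  arc-succ : ∀ {s} → suc s < N → Arc P π g♮ (V s) (V (suc s))
  arc-succ {s} b =
    C2 (s mod N) (suc s mod N) (trans (toℕ-mod b) (cong suc (sym (toℕ-mod (ℕP.<-trans (ℕP.n<1+n s) b)))))

  arc-back : ∀ {s} → suc (s + ℓ) < N → Arc P π g♮ (V (suc (s + ℓ))) (V s)
  arc-back {s} b = C3 (suc (s + ℓ) mod N) (s mod N)
    (trans (toℕ-mod b) (trans (sym (ℕP.+-comm (s + ℓ) 1))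
      (cong (λ t → t + ℓ + 1) (sym (toℕ-mod s<N)))))
    where
    s<N : s < N
    s<N = ℕP.≤-<-trans (ℕP.≤-trans (ℕP.m≤m+n s ℓ) (ℕP.n≤1+n (s + ℓ))) b

  arc-close : Arc P π g♮ (V ℓ) (V 0)
  arc-close = C4 (ℓ mod N) (0 mod N) (toℕ-mod ℓ<N) (toℕ-mod (ℕP.≤-<-trans ℕ.z≤n ℓ<N))

  left-detour : ∀ s → suc s + ℓ < N → Detour g♮ (V (suc s + ℓ)) (V s) (V (suc s))
  left-detour s b = detour g♮ (period-cell (suc s) b)
    (cells-distinct 1 s (ℕ.s≤s ℕ.z≤n) 1<ℓ s1<N)
    (arc-back b) (arc-succ s1<N)
    where
    s1<N : suc s < N
    s1<N = ℕP.≤-<-trans (ℕP.m≤m+n (suc s) ℓ) b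

  right-detour : ∀ s → suc (s + ℓ) < N → Detour g♮ (V (s + ℓ)) (V (suc (s + ℓ))) (V s)
  right-detour s b = detour g♮ (period-cell s (ℕP.<-trans (ℕP.n<1+n (s + ℓ)) b))
    (λ same → cells-distinct 1 s (ℕ.s≤s ℕ.z≤n) 1<ℓ s1<N
                (sym (trans (sym (period-cell (suc s) b)) same)))
    (arc-succ b) (arc-back b)
    where
    s1<N : suc s < N
    s1<N = ℕP.≤-<-trans (ℕP.m≤m+n (suc s) ℓ) b

  colSign : Fin N → Sign
  colSign x = c (colOf g♮ x)

  colSign-cong : ∀ {x y} → SameCell g♮ x y → colSign x ≡ colSign y
  colSign-cong same = cong (λ cell → c (proj₁ cell)) same

  period-precedes : ∀ s → s + ℓ < N → V (s + ℓ) <[ colSign (V s) ] V s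
  period-precedes zero    b = arc-within-cell g♮ (period-cell 0 b) arc-close
  period-precedes (suc s) b = detour-precedes g♮ (period-cell (suc s) b) (left-detour s b)

  multiples-precede : ∀ q s → s + suc q * ℓ < N → V (s + suc q * ℓ) <[ colSign (V s) ] V s
  multiples-precede zero s b rewrite ℕP.+-identityʳ ℓ = period-precedes s b
  multiples-precede (suc q) s b rewrite sym (ℕP.+-assoc s ℓ (suc q * ℓ)) =
    <[]-trans (colSign (V s))
      (subst (λ σ → V (s + ℓ + suc q * ℓ) <[ σ ] V (s + ℓ)) (colSign-cong (period-cell s sℓ<N))
        (multiples-precede q (s + ℓ) b))
      (period-precedes s sℓ<N)
    where
    sℓ<N : s + ℓ < N
    sℓ<N = ℕP.≤-<-trans (ℕP.m≤m+n (s + ℓ) _) b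

  precedes-same-residue : ∀ {s s′} → s < s′ → s′ < N → s % ℓ ≡ s′ % ℓ → V s′ <[ colSign (V s) ] V s
  precedes-same-residue {s} s<s′ s′<N res with %-≡⇒≡+* ℓ res (ℕP.<⇒≤ s<s′)
  ... | zero  , s′≡s+0 = contradiction (trans s′≡s+0 (ℕP.+-identityʳ s)) (ℕP.>⇒≢ s<s′)
  ... | suc q , refl   = multiples-precede q s s′<N

  -- V s′, V (s + ℓ) and V s lie in this order along their common column of the coil gridding.
  convex-along-residue : ∀ g {s s′} → SameCell g (V s) (V s′) → s + ℓ < s′ → s′ < N → s % ℓ ≡ s′ % ℓ →
                         SameCell g (V (s + ℓ)) (V s)
  convex-along-residue g {s} {s′} g-s∼s′ sℓ<s′ s′<N res =
    trans (cell-convex g♮ g (colSign (V s)) s′∼sℓ (period-cell s sℓ<N) s′<sℓ (period-precedes s sℓ<N)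
            (sym g-s∼s′))
          (sym g-s∼s′)
    where
    sℓ<N : s + ℓ < N
    sℓ<N = ℕP.<-trans sℓ<s′ s′<N
    sℓ-res : (s + ℓ) % ℓ ≡ s % ℓ
    sℓ-res = [m+n]%n≡m%n s ℓ
    s′∼sℓ : SameCell g♮ (V s′) (V (s + ℓ))
    s′∼sℓ = same-residue⇒same-cell s′<N sℓ<N (trans (sym res) (sym sℓ-res))
    s′<sℓ : V s′ <[ colSign (V s) ] V (s + ℓ)
    s′<sℓ = subst (λ σ → V s′ <[ σ ] V (s + ℓ)) (colSign-cong (period-cell s sℓ<N))
              (precedes-same-residue sℓ<s′ s′<N (trans sℓ-res res))

  module AroundPair (s : ℕ) (b : suc (suc s + ℓ) < N) where
    p q w₁ w₂ : Fin N
    p  = V (suc s + ℓ)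
    q  = V (suc s)
    w₁ = V s
    w₂ = V (suc (suc s + ℓ))

    s2<N : suc (suc s) < N
    s2<N = ℕP.≤-<-trans (ℕP.m≤m+n (suc (suc s)) ℓ) b
    s1<N : suc s < N
    s1<N = ℕP.<-trans (ℕP.n<1+n (suc s)) s2<N
    s<N : s < N
    s<N = ℕP.<-trans (ℕP.n<1+n s) s1<N

    p∼q : SameCell g♮ p q
    p∼q = period-cell (suc s) (ℕP.<-trans (ℕP.n<1+n _) b)

    w₁≁q : ¬ SameCell g♮ w₁ q
    w₁≁q = cells-distinct 1 s (ℕ.s≤s ℕ.z≤n) 1<ℓ s1<N
    w₂≁q : ¬ SameCell g♮ w₂ q
    w₂≁q w₂∼q =
      cells-distinct 1 (suc s) (ℕ.s≤s ℕ.z≤n) 1<ℓ s2<N (sym (trans (sym (period-cell (suc (suc s)) b)) w₂∼q))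
    w₁≁w₂ : ¬ SameCell g♮ w₁ w₂
    w₁≁w₂ w₁∼w₂ = cells-distinct 2 s (ℕ.s≤s ℕ.z≤n) 2<ℓ s2<N (trans w₁∼w₂ (period-cell (suc (suc s)) b))

    detour₁ : Detour g♮ p w₁ q
    detour₁ = left-detour s (ℕP.<-trans (ℕP.n<1+n _) b)
    detour₂ : Detour g♮ p w₂ q
    detour₂ = right-detour (suc s) b

    not-all-on-one-line : ∀ {X : Set} {L : Cell m n → X} → KindSeparates C L →
               L (cellOf P π g♮ w₁) ≡ L (cellOf P π g♮ q) →
               L (cellOf P π g♮ w₂) ≡ L (cellOf P π g♮ q) → ⊥
    not-all-on-one-line separates L₁≡L₃ L₂≡L₃ =
      [ w₁≁w₂ , [ w₁≁q , w₂≁q ] ]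
        (at-most-two-on-a-line C separates (edge-V s<N) (edge-V b) (edge-V s1<N) L₁≡L₃ L₂≡L₃)

  module InCellOf (g : Gridding P π) (i : Fin m) (j : Fin n) where

    InCell : Fin N → Set
    InCell x = cellOf P π g x ≡ (i , j)

    Continues : ℕ → Set
    Continues s = s + ℓ < N × InCell (V (s + ℓ))

    continues? : Decidable Continues
    continues? s = (s + ℓ ℕ.<? N) ×-dec ≡-dec FinP._≟_ FinP._≟_ (cellOf P π g (V (s + ℓ))) (i , j)

    terminal-by-residue-≤ : ∀ {s s′} → s ≤ s′ → s′ < N → InCell (V s) → InCell (V s′) → ¬ Continues s →
                            s % ℓ ≡ s′ % ℓ → s ≡ s′
    terminal-by-residue-≤ {s} {s′} s≤s′ s′<N s∈ s′∈ ¬cont res with ℕP.<-cmp s′ (s + ℓ)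
    ... | tri< s′<sℓ _ _ = %-injective-window ℓ s≤s′ s′<sℓ res
    ... | tri≈ _ refl _  = contradiction (s′<N , s′∈) ¬cont
    ... | tri> _ _ sℓ<s′ = contradiction
      (ℕP.<-trans sℓ<s′ s′<N , trans (convex-along-residue g (trans s∈ (sym s′∈)) sℓ<s′ s′<N res) s∈) ¬cont

    terminal-by-residue : ∀ {s s′} → s < N → s′ < N → InCell (V s) → InCell (V s′) →
                          ¬ Continues s → ¬ Continues s′ → s % ℓ ≡ s′ % ℓ → s ≡ s′
    terminal-by-residue {s} {s′} s<N s′<N s∈ s′∈ ¬cont ¬cont′ res with ℕP.≤-total s s′
    ... | inj₁ s≤s′ = terminal-by-residue-≤ s≤s′ s′<N s∈ s′∈ ¬cont res
    ... | inj₂ s′≤s = sym (terminal-by-residue-≤ s′≤s s<N s′∈ s∈ ¬cont′ (sym res))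

    data Code : Set where
      last       : ℕ → Code
      first end  : Code
      left right : Fin N → Code

    -- A point V s of the cell is coded by the residue of s if V (s + ℓ) leaves the cell; otherwise by its
    -- position if s is extreme, and else by a point of S next to the pair V s, V (s + ℓ).  Encodes keeps
    -- the code's argument a variable, so that two encodings by the same code can be matched.
    module Encoding (S : Fin N → Set) (S? : Decidable S)
                    (forced : ∀ s → suc (suc s + ℓ) < N → InCell (V (suc s)) → InCell (V (suc s + ℓ)) →
                              S (V s) ⊎ S (V (suc (suc s + ℓ)))) where

      data Encodes : ℕ → Code → Set where
        last  : ∀ {s r} → ¬ Continues s → s % ℓ ≡ r → Encodes s (last r)
        first : Encodes 0 first
        end   : ∀ {s} → suc (s + ℓ) ≡ N → Encodes s end
        left  : ∀ {s w} → V s ≡ w → S w → Encodes (suc s) (left w)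
        right : ∀ {s w} → suc (s + ℓ) < N → V (suc (s + ℓ)) ≡ w → S w → Encodes s (right w)

      encode : ∀ s → InCell (V s) → Σ Code (Encodes s)
      encode zero    _  = first , first
      encode (suc s) s∈ with continues? (suc s)
      ... | no ¬cont = last _ , last ¬cont refl
      ... | yes (b , sℓ∈) with suc (suc s + ℓ) ℕ.<? N
      ...   | no ¬b′ = end , end (ℕP.≤-antisym b (ℕP.≮⇒≥ ¬b′))
      ...   | yes b′ with forced s b′ s∈ sℓ∈
      ...     | inj₁ w∈S = left (V s) , left refl w∈S
      ...     | inj₂ w∈S = right _ , right b′ refl w∈S

      encodes-injective : ∀ {s s′ c} → s < N → s′ < N → InCell (V s) → InCell (V s′) →
                          Encodes s c → Encodes s′ c → s ≡ s′
      encodes-injective s<N s′<N s∈ s′∈ (last ¬cont res) (last ¬cont′ res′) =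
        terminal-by-residue s<N s′<N s∈ s′∈ ¬cont ¬cont′ (trans res (sym res′))
      encodes-injective _ _ _ _ first first = refl
      encodes-injective {s} {s′} _ _ _ _ (end e) (end e′) =
        ℕP.+-cancelʳ-≡ ℓ s s′ (ℕP.suc-injective (trans e (sym e′)))
      encodes-injective s<N s′<N _ _ (left Vs≡w _) (left Vs′≡w _) =
        cong suc (V-injective (ℕP.<-trans (ℕP.n<1+n _) s<N) (ℕP.<-trans (ℕP.n<1+n _) s′<N)
                   (trans Vs≡w (sym Vs′≡w)))
      encodes-injective {s} {s′} _ _ _ _ (right b Vw≡w _) (right b′ Vw′≡w _) =
        ℕP.+-cancelʳ-≡ ℓ s s′ (ℕP.suc-injective (V-injective b b′ (trans Vw≡w (sym Vw′≡w))))

      S-points : List (Fin N)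
      S-points = filter S? (allFin N)

      codes : List Code
      codes = map last (upTo ℓ) ++ first ∷ end ∷ map left S-points ++ map right S-points

      length-codes : length codes ≡ ℓ + (2 + (length S-points + length S-points))
      length-codes = begin
        length codes
          ≡⟨ length-++ (map last (upTo ℓ)) ⟩
        length (map last (upTo ℓ)) + (2 + length (map left S-points ++ map right S-points))
          ≡⟨ cong₂ (λ a b → a + (2 + b)) (trans (length-map last (upTo ℓ)) (length-upTo ℓ))
                   (trans (length-++ (map left S-points))
                          (cong₂ _+_ (length-map left S-points) (length-map right S-points))) ⟩
        ℓ + (2 + (length S-points + length S-points))
          ∎
        where open ≡-Reasoning

      encodes∈codes : ∀ {s c} → Encodes s c → c ∈ codes
      encodes∈codes {s} (last _ refl) = ∈-++⁺ˡ (∈-map⁺ last (∈-upTo⁺ (m%n<n s ℓ)))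
      encodes∈codes first             = ∈-++⁺ʳ (map last (upTo ℓ)) (here refl)
      encodes∈codes (end _)           = ∈-++⁺ʳ (map last (upTo ℓ)) (there (here refl))
      encodes∈codes (left refl w∈S)   =
        ∈-++⁺ʳ (map last (upTo ℓ)) (there (there (∈-++⁺ˡ (∈-map⁺ left (∈-filter⁺ S? (∈-allFin _) w∈S)))))
      encodes∈codes (right _ refl w∈S) =
        ∈-++⁺ʳ (map last (upTo ℓ))
          (there (there (∈-++⁺ʳ (map left S-points) (∈-map⁺ right (∈-filter⁺ S? (∈-allFin _) w∈S)))))

      cellCount≤ : cellCount P π g i j ≤ ℓ + (2 + (length S-points + length S-points))
      cellCount≤ = subst (cellCount P π g i j ≤_) length-codes
        (injective⇒length-filter≤ (λ x → (Gridding.col g x FinP.≟ i) ×-dec (Gridding.row g (π ⟨$⟩ʳ x) FinP.≟ j))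
          codes (allFin⁺ N) code code-injective (λ _ x∈ → encodes∈codes (proj₂ (encode (index _) (index∈ x∈)))))
        where
        index∈ : ∀ {x} → Gridding.col g x ≡ i × Gridding.row g (π ⟨$⟩ʳ x) ≡ j → InCell (V (index x))
        index∈ {x} x∈ = subst InCell (sym (V-index x)) (×-≡,≡→≡ x∈)
        code : ∀ x → Gridding.col g x ≡ i × Gridding.row g (π ⟨$⟩ʳ x) ≡ j → Code
        code x x∈ = proj₁ (encode (index x) (index∈ x∈))
        code-injective : ∀ {x y} x∈ y∈ → code x x∈ ≡ code y y∈ → x ≡ y
        code-injective {x} {y} x∈ y∈ eq = index-injective
          (encodes-injective (index<N x) (index<N y) (index∈ x∈) (index∈ y∈) (proj₂ (encode (index x) (index∈ x∈)))
            (subst (Encodes (index y)) (sym eq) (proj₂ (encode (index y) (index∈ y∈)))))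

    RowNeighbour : Fin N → Set
    RowNeighbour w = rowOf g w ≡ j × colOf g w ≢ i

    row-neighbour? : Decidable RowNeighbour
    row-neighbour? w = (rowOf g w FinP.≟ j) ×-dec ¬? (colOf g w FinP.≟ i)

    row-neighbours≤rowOthers : length (filter row-neighbour? (allFin N)) ≤ rowOthers P π g i j
    row-neighbours≤rowOthers = ℕP.≤-trans
      (length-filter≤sum row-neighbour?
        (λ i′ x → (Gridding.col g x FinP.≟ i′) ×-dec (Gridding.row g (π ⟨$⟩ʳ x) FinP.≟ j))
        (filter (λ i′ → ¬? (i′ FinP.≟ i)) (allFin m)) (allFin⁺ N)
        (λ {x} (row≡j , col≢i) →
           colOf g x , ∈-filter⁺ (λ i′ → ¬? (i′ FinP.≟ i)) (∈-allFin _) col≢i , refl , row≡j))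
      (ℕP.≤-reflexive (sym (rowOthers≡sum P π g i j)))

    row-neighbour : ∀ ρ {p w q} → SameCell g♮ p q → ¬ SameCell g♮ w q → InCell p → InCell q →
                    π ⟨$⟩ʳ p <[ ρ ] π ⟨$⟩ʳ w → π ⟨$⟩ʳ w <[ ρ ] π ⟨$⟩ʳ q → RowNeighbour w
    row-neighbour ρ p∼q w≁q p∈ q∈ p<w w<q =
      let row≡ , col≢ = between-values⇒same-row-other-column g♮ g ρ p∼q w≁q (trans p∈ (sym q∈)) p<w w<q
      in trans row≡ (cong proj₂ q∈) , λ col≡i → col≢ (trans col≡i (sym (cong proj₁ q∈)))

    row-neighbour-forced : ∀ s → suc (suc s + ℓ) < N → InCell (V (suc s)) → InCell (V (suc s + ℓ)) →
                           RowNeighbour (V s) ⊎ RowNeighbour (V (suc (suc s + ℓ)))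
    row-neighbour-forced s b q∈ p∈ = pick detour₁ detour₂
      where
      open AroundPair s b
      pick : Detour g♮ p w₁ q → Detour g♮ p w₂ q → RowNeighbour w₁ ⊎ RowNeighbour w₂
      pick (along-row _ p<w w<q) _                      = inj₁ (row-neighbour _ p∼q w₁≁q p∈ q∈ p<w w<q)
      pick (along-column _ _ _) (along-row _ p<w w<q)   = inj₂ (row-neighbour _ p∼q w₂≁q p∈ q∈ p<w w<q)
      pick (along-column c₁ _ _) (along-column c₂ _ _) = ⊥-elim (not-all-on-one-line (column-separates C) c₁ c₂)

    ColumnNeighbour : Fin N → Set
    ColumnNeighbour w = colOf g w ≡ i × rowOf g w ≢ j

    column-neighbour? : Decidable ColumnNeighbour
    column-neighbour? w = (colOf g w FinP.≟ i) ×-dec ¬? (rowOf g w FinP.≟ j)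

    column-neighbours≤colOthers : length (filter column-neighbour? (allFin N)) ≤ colOthers P π g i j
    column-neighbours≤colOthers = ℕP.≤-trans
      (length-filter≤sum column-neighbour?
        (λ j′ x → (Gridding.col g x FinP.≟ i) ×-dec (Gridding.row g (π ⟨$⟩ʳ x) FinP.≟ j′))
        (filter (λ j′ → ¬? (j′ FinP.≟ j)) (allFin n)) (allFin⁺ N)
        (λ {x} (col≡i , row≢j) →
           rowOf g x , ∈-filter⁺ (λ j′ → ¬? (j′ FinP.≟ j)) (∈-allFin _) row≢j , col≡i , refl))
      (ℕP.≤-reflexive (sym (colOthers≡sum P π g i j)))

    column-neighbour : ∀ κ {p w q} → SameCell g♮ p q → ¬ SameCell g♮ w q → InCell p → InCell q →
                       p <[ κ ] w → w <[ κ ] q → ColumnNeighbour w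
    column-neighbour κ p∼q w≁q p∈ q∈ p<w w<q =
      let col≡ , row≢ = between-positions⇒same-column-other-row g♮ g κ p∼q w≁q (trans p∈ (sym q∈)) p<w w<q
      in trans col≡ (cong proj₁ q∈) , λ row≡j → row≢ (trans row≡j (sym (cong proj₂ q∈)))

    column-neighbour-forced : ∀ s → suc (suc s + ℓ) < N → InCell (V (suc s)) → InCell (V (suc s + ℓ)) →
                              ColumnNeighbour (V s) ⊎ ColumnNeighbour (V (suc (suc s + ℓ)))
    column-neighbour-forced s b q∈ p∈ = pick detour₁ detour₂
      where
      open AroundPair s b
      pick : Detour g♮ p w₁ q → Detour g♮ p w₂ q → ColumnNeighbour w₁ ⊎ ColumnNeighbour w₂
      pick (along-column _ p<w w<q) _                  = inj₁ (column-neighbour _ p∼q w₁≁q p∈ q∈ p<w w<q)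
      pick (along-row _ _ _) (along-column _ p<w w<q)  = inj₂ (column-neighbour _ p∼q w₂≁q p∈ q∈ p<w w<q)
      pick (along-row r₁ _ _) (along-row r₂ _ _)       = ⊥-elim (not-all-on-one-line (row-separates C) r₁ r₂)

    cellCount≤rowOthers : cellCount P π g i j ≤ 2 * ℓ * (rowOthers P π g i j + 1)
    cellCount≤rowOthers = ℓ+2+2S≤2ℓ[R+1] (ℕP.<⇒≤ 2<ℓ)
      (Encoding.cellCount≤ RowNeighbour row-neighbour? row-neighbour-forced) row-neighbours≤rowOthers

    cellCount≤colOthers : cellCount P π g i j ≤ 2 * ℓ * (colOthers P π g i j + 1)
    cellCount≤colOthers = ℓ+2+2S≤2ℓ[R+1] (ℕP.<⇒≤ 2<ℓ)
      (Encoding.cellCount≤ ColumnNeighbour column-neighbour? column-neighbour-forced) column-neighbours≤colOthers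

proposition5p5 : ∀ {m n N : ℕ} (P : PMM m n) (C : Cycle P) (π : Permutation′ N)
                   (g♮ : Gridding P π) → Coil P π g♮ C → (g : Gridding P π) →
                   (∀ i j → 0 < cellCount P π g i j →
                      cellCount P π g i j ≤ 2 * Cycle.len C * (rowOthers P π g i j + 1))
                   × (∀ i j → 0 < cellCount P π g i j →
                      cellCount P π g i j ≤ 2 * Cycle.len C * (colOthers P π g i j + 1))
proposition5p5 P C π g♮ K g =
  (λ i j _ → InCellOf.cellCount≤rowOthers g i j) , (λ i j _ → InCellOf.cellCount≤colOthers g i j)
  where open OnCoil K
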